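{- Let $\Sigma$ be a finite alphabet, $w\in\Sigma^n$, $\pi\in S_\Sigma$, and $z=h_\pi(w)$. If $z[i..j]=z[i'..j']$, then $w[i..j]$ and $w[i'..j']$ are equivalent in the parameterized sense.
   Context: Let $\sigma=|\Sigma|$. $S_\Sigma$ is the set of permutations of $\Sigma$, viewed as words of length $\sigma$ in which each letter of $\Sigma$ occurs exactly once. For $x\in\Sigma^*$, $L(x)$ is the word obtained from $x$ by deleting every letter occurrence except the last occurrence of each letter (so $L(x)$ is a permutation of $\mathrm{Alph}(x)$, the set of letters of $x$). For $a\in\mathrm{Alph}(x)$, $\mathrm{ind}_x(a)$ is the $0$-based index of $a$ in $L(x)$ counted from the right, i.e., the number of distinct letters occurring after the last occurrence of $a$ in $x$. For $\pi\in S_\Sigma$ and $w\in\Sigma^*$, $h_\pi(w)$ is the word $z\in\{0,\ldots,\sigma-1\}^{|w|}$ with $z[t]=\mathrm{ind}_{\pi w[1..t-1]}(w[t])$ for $t=1,\ldots,|w|$. Two words $u,v$ are equivalent in the parameterized sense if $|u|=|v|$ and there is a bijection $f:\mathrm{Alph}(u)\to\mathrm{Alph}(v)$ with $v[t]=f(u[t])$ for all $t$. $x[i..j]$ denotes $x[i]\cdots x[j]$. -}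

module Defs where

open import Data.Nat using (ℕ; zero; suc; _∸_; _+_)
open import Data.Fin using (Fin)
open import Data.Fin.Properties using (_≟_)
open import Data.List using (List; []; _∷_; _++_; [_]; length; take; drop; map)
open import Data.List.Membership.Propositional using (_∈_)
open import Data.List.Relation.Unary.Any using (any?)
open import Data.List.Relation.Unary.Unique.Propositional using (Unique)
open import Data.Product using (Σ; _×_)
open import Relation.Nullary using (yes; no)
open import Relation.Binary.PropositionalEquality using (_≡_)

Word : ℕ → Set
Word σ = List (Fin σ)

-- π ∈ S_Σ : a word of length σ in which every letter occurs exactly once.
IsPerm : (σ : ℕ) → Word σ → Set
IsPerm σ π = length π ≡ σ × Unique π × (∀ (a : Fin σ) → a ∈ π)

L : ∀ {σ} → Word σ → Word σ
L [] = []
L (c ∷ x) with any? (c ≟_) x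
... | yes _ = L x
... | no  _ = c ∷ L x

-- 0-based index of a in a list counted from the right
-- (number of entries after the first occurrence of a; 0 if a is absent).
indR : ∀ {σ} → Fin σ → Word σ → ℕ
indR a [] = 0
indR a (c ∷ l) with a ≟ c
... | yes _ = length l
... | no  _ = indR a l

ind : ∀ {σ} → Word σ → Fin σ → ℕ
ind x a = indR a (L x)

h′ : ∀ {σ} → Word σ → Word σ → List ℕ
h′ p [] = []
h′ p (c ∷ w) = ind p c ∷ h′ (p ++ [ c ]) w

h : ∀ {σ} → Word σ → Word σ → List ℕ
h π w = h′ π w

-- x[i..j] with 1-based inclusive indices.
slice : ∀ {A : Set} → ℕ → ℕ → List A → List A
slice i j x = take (suc j ∸ i) (drop (i ∸ 1) x)

-- Parameterized equivalence: |u| = |v| and a map f, injective on Alph(u),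
-- with v[t] = f(u[t]) for all t (its restriction Alph(u) → Alph(v) is then
-- exactly a bijection, since Alph(v) = f(Alph(u))).
ParamEquiv : ∀ {σ} → Word σ → Word σ → Set
ParamEquiv {σ} u v =
  length u ≡ length v ×
  Σ (Fin σ → Fin σ) (λ f →
    (∀ a b → a ∈ u → b ∈ u → f a ≡ f b → a ≡ b) × map f u ≡ v)

module Submission where

-- Idea of the proof.  z[t] is the position, counted from the right, of w[t]
-- in the "recency list" L(π w[1..t-1]) of the prefix read so far.  Because π
-- contains every letter, every recency list is a permutation of Σ, so the
-- recency lists S and S' in front of the two factors w[i..j] and w[i'..j']
-- determine a bijection g of Σ with map g S = S'.  Reading one more letter
-- moves it to the right end of the recency list (L-snoc), an operation that
-- commutes with any injective renaming; and the letter read is recovered from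
-- its index since indices are injective on a repetition-free list.  Hence if
-- both factors produce the same index sequence, then letter by letter the
-- second factor is the g-image of the first, while the relation
-- map g S = S' is maintained (transport lemma h′-transport).

open import Defs
open import Data.Nat using (ℕ; _≤_; _<_; zero; suc; _∸_)
open import Data.Nat.Properties using (n<1+n; m<n⇒m<1+n; <-irrefl; suc-injective)
open import Data.Fin using (Fin)
open import Data.Fin.Properties using (_≟_)
open import Data.List using (List; []; _∷_; _++_; [_]; length; take; drop; map)
open import Data.List.Properties using (length-map; map-++; ++-assoc; ++-identityʳ; ∷-injectiveˡ; ∷-injectiveʳ)
open import Data.List.Membership.Propositional using (_∈_)
open import Data.List.Membership.Propositional.Properties using (∈-++⁺ˡ; ∈-++⁺ʳ; ∈-++⁻)
open import Data.List.Membership.Propositional.Properties.WithK using (unique∧set⇒bag)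
open import Data.List.Relation.Binary.BagAndSetEquality using (∼bag⇒↭)
open import Data.List.Relation.Binary.Permutation.Propositional.Properties using (↭-length)
open import Data.List.Relation.Unary.Any using (here; there; any?; tail)
open import Data.List.Relation.Unary.All using (All; []; _∷_)
import Data.List.Relation.Unary.All as All
open import Data.List.Relation.Unary.AllPairs using ([]; _∷_)
open import Data.List.Relation.Unary.Unique.Propositional using (Unique)
open import Data.Product using (Σ; _×_; _,_; proj₁; proj₂)
open import Data.Sum using (inj₁; inj₂)
open import Data.Empty using (⊥-elim)
open import Function.Bundles using (mk⇔)
open import Function.Definitions using (Injective)
open import Relation.Nullary using (yes; no; ¬_)
open import Relation.Binary.Definitions using (DecidableEquality)
open import Relation.Binary.PropositionalEquality hiding ([_])
open ≡-Reasoning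

module Lists {A : Set} (_≟ᴬ_ : DecidableEquality A) where

  remove : A → List A → List A
  remove c [] = []
  remove c (a ∷ l) with c ≟ᴬ a
  ... | yes _ = remove c l
  ... | no _ = a ∷ remove c l

  remove-head : ∀ c l → remove c (c ∷ l) ≡ remove c l
  remove-head c l with c ≟ᴬ c
  ... | yes _ = refl
  ... | no c≢c = ⊥-elim (c≢c refl)

  remove-cons : ∀ c a l → ¬ c ≡ a → remove c (a ∷ l) ≡ a ∷ remove c l
  remove-cons c a l c≢a with c ≟ᴬ a
  ... | yes c≡a = ⊥-elim (c≢a c≡a)
  ... | no _ = refl

  remove-map : ∀ (g : A → A) → Injective _≡_ _≡_ g → ∀ c l →
               map g (remove c l) ≡ remove (g c) (map g l)
  remove-map g g-inj c [] = refl
  remove-map g g-inj c (a ∷ l) with c ≟ᴬ a | g c ≟ᴬ g a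
  ... | yes _ | yes _ = remove-map g g-inj c l
  ... | yes c≡a | no gc≢ga = ⊥-elim (gc≢ga (cong g c≡a))
  ... | no c≢a | yes gc≡ga = ⊥-elim (c≢a (g-inj gc≡ga))
  ... | no _ | no _ = cong (g a ∷_) (remove-map g g-inj c l)

  rename : List A → List A → A → A
  rename (x ∷ xs) (y ∷ ys) a with a ≟ᴬ x
  ... | yes _ = y
  ... | no _ = rename xs ys a
  rename _ _ a = a

  rename-skip : ∀ {x y xs ys} l → All (λ b → ¬ x ≡ b) l →
                map (rename (x ∷ xs) (y ∷ ys)) l ≡ map (rename xs ys) l
  rename-skip [] [] = refl
  rename-skip {x} (a ∷ l) (x≢a ∷ x∉l) with a ≟ᴬ x
  ... | yes a≡x = ⊥-elim (x≢a (sym a≡x))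
  ... | no _ = cong (_ ∷_) (rename-skip l x∉l)

  rename-map : ∀ S S' → Unique S → length S ≡ length S' → map (rename S S') S ≡ S'
  rename-map [] [] _ _ = refl
  rename-map (x ∷ xs) (y ∷ ys) (x∉xs ∷ u) len with x ≟ᴬ x
  ... | no x≢x = ⊥-elim (x≢x refl)
  ... | yes _ = cong (y ∷_) (trans (rename-skip xs x∉xs) (rename-map xs ys u (suc-injective len)))

  rename-∈ : ∀ {a} S S' → a ∈ S → length S ≡ length S' → rename S S' a ∈ S'
  rename-∈ {a} (x ∷ xs) (y ∷ ys) a∈S len with a ≟ᴬ x
  ... | yes _ = here refl
  ... | no a≢x = there (rename-∈ xs ys (tail a≢x a∈S) (suc-injective len))

  rename-injective : ∀ {a b} S S' → Unique S' → length S ≡ length S' → a ∈ S → b ∈ S →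
                     rename S S' a ≡ rename S S' b → a ≡ b
  rename-injective {a} {b} (x ∷ xs) (y ∷ ys) (y∉ys ∷ u) len a∈ b∈ eq with a ≟ᴬ x | b ≟ᴬ x
  ... | yes a≡x | yes b≡x = trans a≡x (sym b≡x)
  ... | yes _ | no b≢x = ⊥-elim (All.lookup y∉ys (rename-∈ xs ys (tail b≢x b∈) (suc-injective len)) eq)
  ... | no a≢x | yes _ = ⊥-elim (All.lookup y∉ys (rename-∈ xs ys (tail a≢x a∈) (suc-injective len)) (sym eq))
  ... | no a≢x | no b≢x = rename-injective xs ys u (suc-injective len) (tail a≢x a∈) (tail b≢x b∈) eq

open Lists using (remove; remove-head; remove-cons; remove-map; rename; rename-map; rename-injective)

module _ {σ : ℕ} where

  Complete : Word σ → Set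
  Complete x = ∀ a → a ∈ x

  ∈-L⁻ : ∀ {a} (x : Word σ) → a ∈ L x → a ∈ x
  ∈-L⁻ (c ∷ x) a∈ with any? (c ≟_) x
  ∈-L⁻ (c ∷ x) a∈ | yes _ = there (∈-L⁻ x a∈)
  ∈-L⁻ (c ∷ x) (here a≡c) | no _ = here a≡c
  ∈-L⁻ (c ∷ x) (there a∈) | no _ = there (∈-L⁻ x a∈)

  ∈-L⁺ : ∀ {a} (x : Word σ) → a ∈ x → a ∈ L x
  ∈-L⁺ (c ∷ x) a∈ with any? (c ≟_) x
  ∈-L⁺ (c ∷ x) (here refl) | yes c∈x = ∈-L⁺ x c∈x
  ∈-L⁺ (c ∷ x) (there a∈) | yes _ = ∈-L⁺ x a∈
  ∈-L⁺ (c ∷ x) (here a≡c) | no _ = here a≡c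
  ∈-L⁺ (c ∷ x) (there a∈) | no _ = there (∈-L⁺ x a∈)

  L-unique : (x : Word σ) → Unique (L x)
  L-unique [] = []
  L-unique (c ∷ x) with any? (c ≟_) x
  ... | yes _ = L-unique x
  ... | no c∉x = All.tabulate (λ a∈ c≡a → c∉x (subst (_∈ x) (sym c≡a) (∈-L⁻ x a∈))) ∷ L-unique x

  L-length : ∀ (x y : Word σ) → Complete x → Complete y → length (L x) ≡ length (L y)
  L-length x y cx cy = ↭-length (∼bag⇒↭ (unique∧set⇒bag (L-unique x) (L-unique y)
    (mk⇔ (λ _ → ∈-L⁺ y (cy _)) (λ _ → ∈-L⁺ x (cx _)))))

  L-snoc : ∀ (x : Word σ) c → L (x ++ [ c ]) ≡ remove _≟_ c (L x) ++ [ c ]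
  L-snoc [] c = refl
  L-snoc (y ∷ x) c with any? (y ≟_) (x ++ [ c ]) | any? (y ≟_) x | c ≟ y
  ... | yes _ | yes _ | _ = L-snoc x c
  ... | yes _ | no _ | yes refl = trans (L-snoc x c) (cong (_++ [ c ]) (sym (remove-head _≟_ c (L x))))
  ... | yes y∈xc | no y∉x | no c≢y with ∈-++⁻ x y∈xc
  ...   | inj₁ y∈x = ⊥-elim (y∉x y∈x)
  ...   | inj₂ (here y≡c) = ⊥-elim (c≢y (sym y≡c))
  L-snoc (y ∷ x) c | no y∉xc | yes y∈x | _ = ⊥-elim (y∉xc (∈-++⁺ˡ y∈x))
  L-snoc (y ∷ x) c | no y∉xc | no _ | yes refl = ⊥-elim (y∉xc (∈-++⁺ʳ x (here refl)))
  L-snoc (y ∷ x) c | no _ | no _ | no c≢y =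
    trans (cong (y ∷_) (L-snoc x c)) (cong (_++ [ c ]) (sym (remove-cons _≟_ c y (L x) c≢y)))

  indR-< : ∀ {a} (l : Word σ) → a ∈ l → indR a l < length l
  indR-< {a} (c ∷ l) a∈ with a ≟ c
  ... | yes _ = n<1+n (length l)
  ... | no a≢c = m<n⇒m<1+n (indR-< l (tail a≢c a∈))

  indR-injective : ∀ {a b} (l : Word σ) → a ∈ l → b ∈ l → indR a l ≡ indR b l → a ≡ b
  indR-injective {a} {b} (c ∷ l) a∈ b∈ eq with a ≟ c | b ≟ c
  ... | yes a≡c | yes b≡c = trans a≡c (sym b≡c)
  ... | yes _ | no b≢c = ⊥-elim (<-irrefl (sym eq) (indR-< l (tail b≢c b∈)))
  ... | no a≢c | yes _ = ⊥-elim (<-irrefl eq (indR-< l (tail a≢c a∈)))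
  ... | no a≢c | no b≢c = indR-injective l (tail a≢c a∈) (tail b≢c b∈) eq

  indR-map : ∀ (g : Fin σ → Fin σ) → Injective _≡_ _≡_ g → ∀ a l → indR (g a) (map g l) ≡ indR a l
  indR-map g g-inj a [] = refl
  indR-map g g-inj a (c ∷ l) with g a ≟ g c | a ≟ c
  ... | yes _ | yes _ = length-map g l
  ... | yes ga≡gc | no a≢c = ⊥-elim (a≢c (g-inj ga≡gc))
  ... | no ga≢gc | yes a≡c = ⊥-elim (ga≢gc (cong g a≡c))
  ... | no _ | no _ = indR-map g g-inj a l

  h′-transport : ∀ (g : Fin σ → Fin σ) → Injective _≡_ _≡_ g → (p p' u v : Word σ) →
                 Complete p → Complete p' → map g (L p) ≡ L p' → h′ p u ≡ h′ p' v → map g u ≡ v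
  h′-transport g g-inj p p' [] [] cp cp' gS≡S' eqh = refl
  h′-transport g g-inj p p' (c ∷ u) (c' ∷ v) cp cp' gS≡S' eqh =
    cong₂ _∷_ gc≡c' (h′-transport g g-inj (p ++ [ c ]) (p' ++ [ c' ]) u v
      (λ a → ∈-++⁺ˡ (cp a)) (λ a → ∈-++⁺ˡ (cp' a)) next-recency (∷-injectiveʳ eqh))
    where
    -- The first letters correspond: they have the same index.
    gc≡c' : g c ≡ c'
    gc≡c' = indR-injective (L p') (∈-L⁺ p' (cp' (g c))) (∈-L⁺ p' (cp' c'))
      (begin
        indR (g c) (L p')         ≡⟨ cong (indR (g c)) gS≡S' ⟨
        indR (g c) (map g (L p))  ≡⟨ indR-map g g-inj c (L p) ⟩
        indR c (L p)              ≡⟨ ∷-injectiveˡ eqh ⟩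
        indR c' (L p')            ∎)
    next-recency : map g (L (p ++ [ c ])) ≡ L (p' ++ [ c' ])
    next-recency = begin
      map g (L (p ++ [ c ]))                    ≡⟨ cong (map g) (L-snoc p c) ⟩
      map g (remove _≟_ c (L p) ++ [ c ])       ≡⟨ map-++ g (remove _≟_ c (L p)) [ c ] ⟩
      map g (remove _≟_ c (L p)) ++ [ g c ]     ≡⟨ cong (_++ [ g c ]) (remove-map _≟_ g g-inj c (L p)) ⟩
      remove _≟_ (g c) (map g (L p)) ++ [ g c ] ≡⟨ cong (λ S → remove _≟_ (g c) S ++ [ g c ]) gS≡S' ⟩
      remove _≟_ (g c) (L p') ++ [ g c ]        ≡⟨ cong (λ d → remove _≟_ d (L p') ++ [ d ]) gc≡c' ⟩
      remove _≟_ c' (L p') ++ [ c' ]            ≡⟨ L-snoc p' c' ⟨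
      L (p' ++ [ c' ])                          ∎

  recency-renaming : ∀ (p p' : Word σ) → Complete p → Complete p' →
    Σ (Fin σ → Fin σ) (λ g → Injective _≡_ _≡_ g × map g (L p) ≡ L p')
  recency-renaming p p' cp cp' =
      rename _≟_ (L p) (L p')
    , (λ {a} {b} → rename-injective _≟_ (L p) (L p') (L-unique p') len (∈-L⁺ p (cp a)) (∈-L⁺ p (cp b)))
    , rename-map _≟_ (L p) (L p') (L-unique p) len
    where
    len : length (L p) ≡ length (L p')
    len = L-length p p' cp cp'

  h′-drop : ∀ k (p w : Word σ) → drop k (h′ p w) ≡ h′ (p ++ take k w) (drop k w)
  h′-drop zero p w = cong (λ q → h′ q w) (sym (++-identityʳ p))
  h′-drop (suc k) p [] = refl
  h′-drop (suc k) p (c ∷ w) =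
    trans (h′-drop k (p ++ [ c ]) w) (cong (λ q → h′ q (drop k w)) (++-assoc p [ c ] (take k w)))

  h′-take : ∀ m (p w : Word σ) → take m (h′ p w) ≡ h′ p (take m w)
  h′-take zero p w = refl
  h′-take (suc m) p [] = refl
  h′-take (suc m) p (c ∷ w) = cong (ind p c ∷_) (h′-take m (p ++ [ c ]) w)

  slice-h : ∀ i j (π w : Word σ) → slice i j (h π w) ≡ h′ (π ++ take (i ∸ 1) w) (slice i j w)
  slice-h i j π w = trans (cong (take (suc j ∸ i)) (h′-drop (i ∸ 1) π w))
                          (h′-take (suc j ∸ i) (π ++ take (i ∸ 1) w) (drop (i ∸ 1) w))

lemma23 : (σ n : ℕ) (w π : Word σ) → length w ≡ n → IsPerm σ π →
          (i j i′ j′ : ℕ) → 1 ≤ i → i ≤ j → j ≤ n → 1 ≤ i′ → i′ ≤ j′ → j′ ≤ n →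
          slice i j (h π w) ≡ slice i′ j′ (h π w) →
          ParamEquiv (slice i j w) (slice i′ j′ w)
lemma23 σ n w π _ (_ , _ , π-complete) i j i′ j′ _ _ _ _ _ _ eq =
  length-eq , g , (λ _ _ _ _ → g-inj) , g-maps
  where
  p p′ u v : Word σ
  p = π ++ take (i ∸ 1) w
  p′ = π ++ take (i′ ∸ 1) w
  u = slice i j w
  v = slice i′ j′ w
  cp : Complete p
  cp a = ∈-++⁺ˡ (π-complete a)
  cp′ : Complete p′
  cp′ a = ∈-++⁺ˡ (π-complete a)
  same-indices : h′ p u ≡ h′ p′ v
  same-indices = trans (sym (slice-h i j π w)) (trans eq (slice-h i′ j′ π w))
  correspondence : Σ (Fin σ → Fin σ) (λ g → Injective _≡_ _≡_ g × map g (L p) ≡ L p′)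
  correspondence = recency-renaming p p′ cp cp′
  g : Fin σ → Fin σ
  g = proj₁ correspondence
  g-inj : Injective _≡_ _≡_ g
  g-inj = proj₁ (proj₂ correspondence)
  g-maps : map g u ≡ v
  g-maps = h′-transport g g-inj p p′ u v cp cp′ (proj₂ (proj₂ correspondence)) same-indices
  length-eq : length u ≡ length v
  length-eq = trans (sym (length-map g u)) (cong length g-maps)
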